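{- Let $x\in\mathbb{R}$ and $t\in\mathbb{N}$. (i) Let $a$ be a token with $\mathsf{H}_t(a)\ge x$, and suppose the vertex $\mathsf{P}_t(a)$ is matched in $M_t$ with a vertex $v$. If $\Gamma_t(v)\le x$, then $\mathsf{H}_{t+1}(a)-x\le\left\lceil\frac{\mathsf{H}_t(a)-x}{2}\right\rceil$. (ii) Let $b$ be a complementary token with $\overline{\mathsf{H}}_t(b)\ge x$, and suppose $\overline{\mathsf{P}}_t(b)$ is matched in $M_t$ with a vertex $u$. If $\overline{\Gamma}_t(u)\le x$, then $\overline{\mathsf{H}}_{t+1}(b)-x\le\left\lceil\frac{\overline{\mathsf{H}}_t(b)-x}{2}\right\rceil$.
   Context: Random matching algorithm: token configurations $\Gamma_t\in\mathbb{N}^V$ on a vertex set $V$, $K=\sum_v\Gamma_0(v)$; at each time $t$ a matching $M_t$ is given, and for each $\{v,u\}\in M_t$ with $s=\Gamma_t(v)+\Gamma_t(u)$ the new loads are $(\lceil s/2\rceil,\lfloor s/2\rfloor)$ or $(\lfloor s/2\rfloor,\lceil s/2\rceil)$ (random choice); unmatched vertices keep their loads. Token refinement: the $K$ tokens are distinct; each token $a$ has a place $\mathsf{P}_t(a)\in V$ and a height $\mathsf{H}_t(a)\ge1$, and for each $v$ the heights of tokens placed on $v$ are exactly $\{1,\dots,\Gamma_t(v)\}$. Update at time $t$: tokens on unmatched vertices stay. For $\{v,u\}\in M_t$ with $\Gamma_t(v)\ge\Gamma_t(u)$ (larger pile on $v$): tokens of height $\le\Gamma_t(u)$ stay where they are;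 a token on $v$ with height $h>\Gamma_t(u)$, where $h-\Gamma_t(u)\in\{2k-1,2k\}$ ($k\ge1$), moves to height $\Gamma_t(u)+k$ and is placed on $v$ or $u$, the two tokens with $h-\Gamma_t(u)=2k-1$ and $2k$ going to different vertices, the orientation being the one that produces the loads $\Gamma_{t+1}(v),\Gamma_{t+1}(u)$ chosen by the rounding. Complementary tokens: $\overline{\Gamma}_t(v)=K-\Gamma_t(v)$. A second family of $K(n-1)$ complementary tokens $b$ with places $\overline{\mathsf{P}}_t(b)$ and heights $\overline{\mathsf{H}}_t(b)$ realizes the loads $\overline{\Gamma}_t$ and is updated by exactly the same procedure applied to $\overline{\Gamma}_t$, with the same matchings $M_t$ (the loads $\overline{\Gamma}_{t+1}=K-\Gamma_{t+1}$ being those induced by the rounding of $\Gamma$).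
   Formalization: The number x ranges over the rationals instead of the reals. -}

module Defs where

open import Data.Nat using (ℕ; zero; suc; _+_; _*_; _∸_; _≤_; _≤?_; ⌈_/2⌉; ⌊_/2⌋)
open import Data.Fin using (Fin)
open import Data.Bool using (Bool; true; false; if_then_else_; _xor_)
open import Data.Maybe using (Maybe; just; nothing)
open import Data.Product using (_×_; Σ; ∃; _,_)
open import Data.Sum using (_⊎_)
open import Relation.Nullary using (yes; no; ¬_)
open import Relation.Binary.PropositionalEquality using (_≡_)
import Data.Integer as ℤ
import Data.Rational as ℚ

-- A matching on the vertex set Fin n, given by a partial "partner" map:
-- m v ≡ just u  means  {v,u} ∈ M ;  m v ≡ nothing  means v is unmatched.
Matching : ℕ → Set
Matching n = Fin n → Maybe (Fin n)

IsMatching : {n : ℕ} → Matching n → Set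
IsMatching {n} m = (v u : Fin n) → m v ≡ just u → (m u ≡ just v) × ¬ (v ≡ u)

Load : ℕ → Set
Load n = Fin n → ℕ

-- One rounding step of the random matching algorithm (any outcome of the
-- random choices): unmatched vertices keep their loads, a matched pair {v,u}
-- with s = Γ v + Γ u gets (⌈s/2⌉,⌊s/2⌋) or (⌊s/2⌋,⌈s/2⌉).
LoadStep : {n : ℕ} → Matching n → Load n → Load n → Set
LoadStep {n} m Γ Γ' =
  ((v : Fin n) → m v ≡ nothing → Γ' v ≡ Γ v) ×
  ((v u : Fin n) → m v ≡ just u →
      ((Γ' v ≡ ⌈ Γ v + Γ u /2⌉) × (Γ' u ≡ ⌊ Γ v + Γ u /2⌋))
    ⊎ ((Γ' v ≡ ⌊ Γ v + Γ u /2⌋) × (Γ' u ≡ ⌈ Γ v + Γ u /2⌉)))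

record Realizes {n N : ℕ} (Γ : Load n) (P : Fin N → Fin n) (H : Fin N → ℕ) : Set where
  field
    height-range : (a : Fin N) → (1 ≤ H a) × (H a ≤ Γ (P a))
    height-onto  : (v : Fin n) (h : ℕ) → 1 ≤ h → h ≤ Γ v →
                   Σ (Fin N) (λ a → (P a ≡ v) × (H a ≡ h))
    height-inj   : (a b : Fin N) → P a ≡ P b → H a ≡ H b → a ≡ b

oddᵇ : ℕ → Bool
oddᵇ zero = false
oddᵇ (suc k) = if oddᵇ k then false else true

-- For a matched token whose height exceeds the load of the partner u
-- (so v carries the larger pile), with d = h - Γ u ∈ {2k-1, 2k}, the new height
-- is Γ u + k = Γ u + ⌈d/2⌉, and the token goes to v or u according to the parity
-- of d and the orientation bit σ v (odd- and even-offset tokens of the same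
-- pair go to different vertices; one orientation per matched edge).
TokStep : {n : ℕ} → Matching n → Load n → (Fin n → Bool) →
          Fin n → ℕ → Fin n → ℕ → Set
TokStep m Γ σ v h v' h' with m v
... | nothing = (v' ≡ v) × (h' ≡ h)
... | just u with h ≤? Γ u
...   | yes _ = (v' ≡ v) × (h' ≡ h)
...   | no _  = (h' ≡ Γ u + ⌈ h ∸ Γ u /2⌉) ×
                (v' ≡ (if σ v xor oddᵇ (h ∸ Γ u) then u else v))

record TokenStep {n N : ℕ} (m : Matching n) (Γ Γ' : Load n)
                 (P P' : Fin N → Fin n) (H H' : Fin N → ℕ) : Set where
  field
    orient    : Fin n → Bool
    move      : (a : Fin N) → TokStep m Γ orient (P a) (H a) (P' a) (H' a)
    realizes' : Realizes Γ' P' H'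

compl : {n : ℕ} → ℕ → Load n → Load n
compl K Γ v = K ∸ Γ v

record Run (n K : ℕ) (M : ℕ → Matching n) : Set where
  field
    Γ  : ℕ → Load n
    P  : ℕ → Fin K → Fin n
    H  : ℕ → Fin K → ℕ
    P̄  : ℕ → Fin (K * (n ∸ 1)) → Fin n
    H̄  : ℕ → Fin (K * (n ∸ 1)) → ℕ
    matching  : (t : ℕ) → IsMatching (M t)
    init      : Realizes (Γ 0) (P 0) (H 0)
    init̄      : Realizes (compl K (Γ 0)) (P̄ 0) (H̄ 0)
    loadStep  : (t : ℕ) → LoadStep (M t) (Γ t) (Γ (suc t))
    tokStep   : (t : ℕ) → TokenStep (M t) (Γ t) (Γ (suc t)) (P t) (P (suc t)) (H t) (H (suc t))
    tokStep̄   : (t : ℕ) → TokenStep (M t) (compl K (Γ t)) (compl K (Γ (suc t)))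
                                    (P̄ t) (P̄ (suc t)) (H̄ t) (H̄ (suc t))

ℕ→ℚ : ℕ → ℚ.ℚ
ℕ→ℚ k = ℤ.+ k ℚ./ 1

ℤ→ℚ : ℤ.ℤ → ℚ.ℚ
ℤ→ℚ z = z ℚ./ 1

ceilℚ : ℚ.ℚ → ℚ.ℚ
ceilℚ q = ℤ→ℚ (ℚ.⌈ q ⌉)

{-# OPTIONS --safe #-}
-- A token at height h whose partner carries g < h tokens moves to height
-- g + ⌈(h − g)/2⌉.  Since g ≤ x, halving the offset above g instead of the
-- offset above x costs at most the rounding, and the outer ceiling absorbs
-- it: either ⌈(h − g)/2⌉ ≤ ⌈(h − x)/2⌉ outright, or the integer gap forces
-- x ≥ g + 1.  A token with h ≤ g stays put, which is the degenerate case g = h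
-- of the same bound.  Complementary tokens move by the same rule, so both
-- parts are one bound on TokStep.
module Submission where

open import Defs
open import Data.Nat using (ℕ; suc)
open import Data.Fin using (Fin)
open import Data.Maybe using (just)
open import Data.Product using (_×_; _,_; proj₁; proj₂)
open import Relation.Binary.PropositionalEquality
  using (_≡_; refl; sym; trans; cong; cong₂; subst; subst₂)
open import Relation.Nullary using (Dec; yes; no)
open import Data.Rational using (ℚ; _≤_; _-_; _*_; ½)
open import Data.Rational.Base using (mkℚ; _+_; 1ℚ; -_; ↥_; ↧_; *≤*; ceiling; floor)
open import Data.Rational.Solver using (module +-*-Solver)
import Data.Rational.Properties as ℚₚ
import Data.Integer as ℤ
import Data.Integer.Properties as ℤₚ
open import Data.Integer.DivMod using ([n/d]*d≤n)
import Data.Nat as ℕ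
import Data.Nat.Properties as ℕₚ
import Data.Nat.Coprimality as Coprime

ℤ→ℚ≡mkℚ : ∀ i → ℤ→ℚ i ≡ mkℚ i 0 (Coprime.sym (Coprime.1-coprimeTo _))
ℤ→ℚ≡mkℚ i = ℚₚ.↥p/↧p≡p (mkℚ i 0 (Coprime.sym (Coprime.1-coprimeTo _)))

ℤ→ℚ-mono-≤ : ∀ {i j} → i ℤ.≤ j → ℤ→ℚ i ≤ ℤ→ℚ j
ℤ→ℚ-mono-≤ {i} {j} i≤j rewrite ℤ→ℚ≡mkℚ i | ℤ→ℚ≡mkℚ j =
  *≤* (subst₂ ℤ._≤_ (sym (ℤₚ.*-identityʳ i)) (sym (ℤₚ.*-identityʳ j)) i≤j)

ℤ→ℚ-homo-+ : ∀ i j → ℤ→ℚ (i ℤ.+ j) ≡ ℤ→ℚ i + ℤ→ℚ j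
ℤ→ℚ-homo-+ i j rewrite ℤ→ℚ≡mkℚ i | ℤ→ℚ≡mkℚ j =
  sym (ℚₚ./-cong (cong₂ ℤ._+_ (ℤₚ.*-identityʳ i) (ℤₚ.*-identityʳ j)) refl)

ℕ→ℚ-mono-≤ : ∀ {m n} → m ℕ.≤ n → ℕ→ℚ m ≤ ℕ→ℚ n
ℕ→ℚ-mono-≤ m≤n = ℤ→ℚ-mono-≤ (ℤ.+≤+ m≤n)

ℕ→ℚ-homo-+ : ∀ m n → ℕ→ℚ (m ℕ.+ n) ≡ ℕ→ℚ m + ℕ→ℚ n
ℕ→ℚ-homo-+ m n = ℤ→ℚ-homo-+ (ℤ.+ m) (ℤ.+ n)

⌊p⌋*↧p≤↥p : ∀ p → floor p ℤ.* ↧ p ℤ.≤ ↥ p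
⌊p⌋*↧p≤↥p p@(mkℚ _ _ _) = [n/d]*d≤n (↥ p) (↧ p)

p≤ceilℚp : ∀ p → p ≤ ceilℚ p
p≤ceilℚp p@(mkℚ i _ _) rewrite ℤ→ℚ≡mkℚ (ceiling p) = *≤* i≤⌈p⌉*↧p
  where
  ⌊-p⌋*↧p≤-i : floor (- p) ℤ.* ↧ p ℤ.≤ ℤ.- i
  ⌊-p⌋*↧p≤-i = subst₂ (λ d n → floor (- p) ℤ.* d ℤ.≤ n) (ℚₚ.↧-neg p) (ℚₚ.↥-neg p)
                      (⌊p⌋*↧p≤↥p (- p))
  i≤⌈p⌉*↧p : i ℤ.* ℤ.+ 1 ℤ.≤ ceiling p ℤ.* ↧ p
  i≤⌈p⌉*↧p = subst₂ ℤ._≤_ (trans (ℤₚ.neg-involutive i) (sym (ℤₚ.*-identityʳ i)))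
                          (ℤₚ.neg-distribˡ-* (floor (- p)) (↧ p))
                          (ℤₚ.neg-mono-≤ ⌊-p⌋*↧p≤-i)

⌈n/2⌉+⌈n/2⌉≤1+n : ∀ n → ℕ.⌈ n /2⌉ ℕ.+ ℕ.⌈ n /2⌉ ℕ.≤ suc n
⌈n/2⌉+⌈n/2⌉≤1+n n = ℕₚ.≤-trans (ℕₚ.+-monoʳ-≤ ℕ.⌈ n /2⌉ (ℕₚ.⌊n/2⌋≤⌈n/2⌉ (suc n)))
                               (ℕₚ.≤-reflexive (ℕₚ.⌊n/2⌋+⌈n/2⌉≡n (suc n)))

n+⌈n∸n/2⌉≡n : ∀ n → n ℕ.+ ℕ.⌈ n ℕ.∸ n /2⌉ ≡ n
n+⌈n∸n/2⌉≡n n = trans (cong (λ d → n ℕ.+ ℕ.⌈ d /2⌉) (ℕₚ.n∸n≡0 n)) (ℕₚ.+-identityʳ n)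

module _ {G K X C : ℚ} where
  open ℚₚ.≤-Reasoning
  open +-*-Solver

  offset-bound-small : G ≤ X → K ≤ C → (G + K) - X ≤ C
  offset-bound-small G≤X K≤C = begin
    (G + K) - X  ≤⟨ ℚₚ.+-monoˡ-≤ (- X) (ℚₚ.+-monoˡ-≤ K G≤X) ⟩
    (X + K) - X  ≡⟨ solve 2 (λ X K → (X :+ K) :- X := K) refl X K ⟩
    K            ≤⟨ K≤C ⟩
    C            ∎

  offset-bound-large : ∀ {H} → ½ * (H - X) ≤ C → (K + K) + G ≤ H + 1ℚ → 1ℚ + C ≤ K →
                       (G + K) - X ≤ C
  offset-bound-large {H} half≤C 2K+G≤H+1 1+C≤K = begin
    (G + K) - X
      ≡⟨ solve 3 (λ G K X → (G :+ K) :- X := (((K :+ K) :+ G) :- X) :- K) refl G K X ⟩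
    (((K + K) + G) - X) - K
      ≤⟨ ℚₚ.+-monoˡ-≤ (- K) (ℚₚ.+-monoˡ-≤ (- X) 2K+G≤H+1) ⟩
    ((H + 1ℚ) - X) - K
      ≡⟨ solve 3 (λ H X K → ((H :+ con 1ℚ) :- X) :- K
                          := ((con ½ :* (H :- X) :+ con ½ :* (H :- X)) :+ con 1ℚ) :- K) refl H X K ⟩
    ((½ * (H - X) + ½ * (H - X)) + 1ℚ) - K
      ≤⟨ ℚₚ.+-monoˡ-≤ (- K) (ℚₚ.+-monoˡ-≤ 1ℚ (ℚₚ.+-mono-≤ half≤C half≤C)) ⟩
    ((C + C) + 1ℚ) - K
      ≤⟨ ℚₚ.+-monoʳ-≤ ((C + C) + 1ℚ) (ℚₚ.neg-antimono-≤ 1+C≤K) ⟩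
    ((C + C) + 1ℚ) - (1ℚ + C)
      ≡⟨ solve 1 (λ C → ((C :+ C) :+ con 1ℚ) :- (con 1ℚ :+ C) := C) refl C ⟩
    C ∎

halved-offset-bound : ∀ g h x → g ℕ.≤ h → ℕ→ℚ g ≤ x →
                      ℕ→ℚ (g ℕ.+ ℕ.⌈ h ℕ.∸ g /2⌉) - x ≤ ceilℚ (½ * (ℕ→ℚ h - x))
halved-offset-bound g h x g≤h g≤x =
  subst (λ q → q - x ≤ ℤ→ℚ c) (sym (ℕ→ℚ-homo-+ g k)) (by-cases (ℤ.+ k ℤₚ.≤? c))
  where
  k = ℕ.⌈ h ℕ.∸ g /2⌉
  c = ceiling (½ * (ℕ→ℚ h - x))

  2k+g≤h+1 : k ℕ.+ k ℕ.+ g ℕ.≤ h ℕ.+ 1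
  2k+g≤h+1 = begin
    k ℕ.+ k ℕ.+ g       ≤⟨ ℕₚ.+-monoˡ-≤ g (⌈n/2⌉+⌈n/2⌉≤1+n (h ℕ.∸ g)) ⟩
    suc (h ℕ.∸ g ℕ.+ g) ≡⟨ cong suc (ℕₚ.m∸n+n≡m g≤h) ⟩
    suc h               ≡⟨ ℕₚ.+-comm 1 h ⟩
    h ℕ.+ 1             ∎
    where open ℕₚ.≤-Reasoning

  2K+G≤H+1 : (ℕ→ℚ k + ℕ→ℚ k) + ℕ→ℚ g ≤ ℕ→ℚ h + 1ℚ
  2K+G≤H+1 = subst₂ _≤_ (trans (ℕ→ℚ-homo-+ (k ℕ.+ k) g) (cong (_+ ℕ→ℚ g) (ℕ→ℚ-homo-+ k k)))
                        (ℕ→ℚ-homo-+ h 1)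
                        (ℕ→ℚ-mono-≤ 2k+g≤h+1)

  by-cases : Dec (ℤ.+ k ℤ.≤ c) → (ℕ→ℚ g + ℕ→ℚ k) - x ≤ ℤ→ℚ c
  by-cases (yes k≤c) = offset-bound-small g≤x (ℤ→ℚ-mono-≤ k≤c)
  by-cases (no  k≰c) = offset-bound-large {H = ℕ→ℚ h} (p≤ceilℚp (½ * (ℕ→ℚ h - x))) 2K+G≤H+1
    (subst (_≤ ℕ→ℚ k) (ℤ→ℚ-homo-+ (ℤ.+ 1) c) (ℤ→ℚ-mono-≤ (ℤₚ.i<j⇒suc[i]≤j (ℤₚ.≰⇒> k≰c))))

TokStep-height-bound : ∀ {n} (m : Matching n) (Γ : Load n) σ {p h p′ h′} v x →
                       m p ≡ just v → TokStep m Γ σ p h p′ h′ → ℕ→ℚ (Γ v) ≤ x →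
                       ℕ→ℚ h′ - x ≤ ceilℚ (½ * (ℕ→ℚ h - x))
TokStep-height-bound m Γ σ {p} {h} v x m[p]≡v step Γv≤x
  with m p | m[p]≡v
... | just .v | refl with h ℕ.≤? Γ v
...   | yes h≤Γv = subst (λ q → ℕ→ℚ q - x ≤ ceilℚ (½ * (ℕ→ℚ h - x)))
                         (trans (n+⌈n∸n/2⌉≡n h) (sym (proj₂ step)))
                         (halved-offset-bound h h x ℕₚ.≤-refl (ℚₚ.≤-trans (ℕ→ℚ-mono-≤ h≤Γv) Γv≤x))
...   | no  h≰Γv = subst (λ q → ℕ→ℚ q - x ≤ ceilℚ (½ * (ℕ→ℚ h - x)))
                         (sym (proj₁ step))
                         (halved-offset-bound (Γ v) h x (ℕₚ.<⇒≤ (ℕₚ.≰⇒> h≰Γv)) Γv≤x)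

lemma2 : (n K : ℕ) (M : ℕ → Matching n) (R : Run n K M) (x : ℚ) (t : ℕ) →
    ((a : Fin K) (v : Fin n) →
       x ≤ ℕ→ℚ (Run.H R t a) →
       M t (Run.P R t a) ≡ just v →
       ℕ→ℚ (Run.Γ R t v) ≤ x →
       ℕ→ℚ (Run.H R (suc t) a) - x ≤ ceilℚ (½ * (ℕ→ℚ (Run.H R t a) - x)))
    ×
    ((b : Fin (K Data.Nat.* (n Data.Nat.∸ 1))) (u : Fin n) →
       x ≤ ℕ→ℚ (Run.H̄ R t b) →
       M t (Run.P̄ R t b) ≡ just u →
       ℕ→ℚ (compl K (Run.Γ R t) u) ≤ x →
       ℕ→ℚ (Run.H̄ R (suc t) b) - x ≤ ceilℚ (½ * (ℕ→ℚ (Run.H̄ R t b) - x)))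
lemma2 _ K M R x t =
  (λ a v _ m[P]≡v Γv≤x →
     TokStep-height-bound (M t) (Γ t) (orient (tokStep t)) v x m[P]≡v (move (tokStep t) a) Γv≤x) ,
  (λ b u _ m[P̄]≡u Γ̄u≤x →
     TokStep-height-bound (M t) (compl K (Γ t)) (orient (tokStep̄ t)) u x m[P̄]≡u (move (tokStep̄ t) b) Γ̄u≤x)
  where
  open Run R
  open TokenStep
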